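{- For general Boolean functions $f$ and $g$, $\mathrm{Rank}(f\circ g)$ cannot be bounded by any function of $\mathrm{Rank}(f)$ and $\mathrm{Rank}(g)$ alone; that is, there is no function $B:\mathbb{N}\times\mathbb{N}\to\mathbb{N}$ such that $\mathrm{Rank}(f\circ g)\le B(\mathrm{Rank}(f),\mathrm{Rank}(g))$ for all Boolean functions $f,g$.
   Context: For $f$ on $n$ variables and $g$ on $m$ variables, $f\circ g:\{0,1\}^{nm}\to\{0,1\}$ is $(a^1,\dots,a^n)\mapsto f(g(a^1),\dots,g(a^n))$. A decision tree queries single variables at internal nodes and has $0/1$ leaves. Rank of a rooted binary tree: leaves have rank $0$; an internal node with children of ranks $a,b$ has rank $a+1$ if $a=b$, else $\max\{a,b\}$; $\mathrm{Rank}(f)$ is the minimum rank of a decision tree computing $f$. -}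

module Defs where

open import Data.Nat using (ℕ; zero; suc; _≤_)
open import Data.Nat.Base using (_⊔_)
open import Data.Bool using (Bool; true; false; if_then_else_)
open import Data.Fin using (Fin)
open import Data.Product using (_×_; _,_; ∃)
open import Relation.Binary.PropositionalEquality using (_≡_)

BoolFn : ℕ → Set
BoolFn n = (Fin n → Bool) → Bool

-- Composition f ∘ g : {0,1}^{nm} → {0,1}; the nm variables are indexed by
-- Fin n × Fin m, (i , j) being the j-th bit of the i-th block a^i.
_∘ᵇ_ : ∀ {n m} → BoolFn n → BoolFn m → ((Fin n × Fin m) → Bool) → Bool
(f ∘ᵇ g) x = f (λ i → g (λ j → x (i , j)))

data DTree (V : Set) : Set where
  leaf : Bool → DTree V
  node : V → DTree V → DTree V → DTree V

eval : ∀ {V} → DTree V → (V → Bool) → Bool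
eval (leaf b) x = b
eval (node v t₀ t₁) x = if x v then eval t₁ x else eval t₀ x

rankCombine : ℕ → ℕ → ℕ
rankCombine zero zero = 1
rankCombine zero (suc b) = suc b
rankCombine (suc a) zero = suc a
rankCombine (suc a) (suc b) = suc (rankCombine a b)

rank : ∀ {V} → DTree V → ℕ
rank (leaf _) = 0
rank (node _ t₀ t₁) = rankCombine (rank t₀) (rank t₁)

Computes : ∀ {V} → DTree V → ((V → Bool) → Bool) → Set
Computes t f = ∀ x → eval t x ≡ f x

IsRank : ∀ {V} → ((V → Bool) → Bool) → ℕ → Set
IsRank {V} f r =
  (∃ λ (t : DTree V) → Computes t f × rank t ≡ r)
  × (∀ (t : DTree V) → Computes t f → r ≤ rank t)

{-# OPTIONS --safe #-}
-- AND_k ∘ OR₂ has rank k while AND_k and OR₂ have rank 1. For the lower bound an adversary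
-- keeps each undecided OR-block free. A query into a fixed block is answered by the block; a
-- query into a free block is answered as the querier likes, the block being fixed to all
-- ones or to a zero at the queried bit and a one at the other, so that it still evaluates
-- to 1. Either way one free block is spent, and while a free block remains the function is
-- undetermined, so both subtrees of such a query need rank at least (free blocks − 1).
module Submission where

open import Defs
open import Data.Nat using (ℕ; zero; suc; _+_; _≤_; _<_; z≤n; s≤s)
open import Data.Nat.Properties using (≤-refl; ≤-trans; +-suc; suc-injective; ≮⇒≥; 1+n≰n)
open import Data.Bool using (Bool; true; false; _∧_; _∨_; if_then_else_)
open import Data.Fin using (Fin; zero; suc; _≟_)
open import Data.Maybe using (Maybe; just; nothing; maybe′; fromMaybe)
open import Data.Product using (∃; ∃₂; _×_; _,_; uncurry; map₁)
open import Data.Unit using (⊤; tt)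
open import Data.Vec.Functional using (Vector; updateAt)
open import Data.Vec.Functional.Properties using (updateAt-updates; updateAt-minimal)
open import Function using (const)
open import Relation.Nullary using (¬_; yes; no; contradiction)
open import Relation.Binary.PropositionalEquality
  using (_≡_; _≢_; refl; sym; trans; cong; subst)

≤-rankCombineˡ : ∀ a b → a ≤ rankCombine a b
≤-rankCombineˡ zero    b       = z≤n
≤-rankCombineˡ (suc a) zero    = ≤-refl
≤-rankCombineˡ (suc a) (suc b) = s≤s (≤-rankCombineˡ a b)

≤-rankCombineʳ : ∀ a b → b ≤ rankCombine a b
≤-rankCombineʳ zero    zero    = z≤n
≤-rankCombineʳ zero    (suc b) = ≤-refl
≤-rankCombineʳ (suc a) zero    = z≤n
≤-rankCombineʳ (suc a) (suc b) = s≤s (≤-rankCombineʳ a b)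

<-rankCombine : ∀ {r a b} → r ≤ a → r ≤ b → r < rankCombine a b
<-rankCombine {a = zero}  {zero}  z≤n z≤n = s≤s z≤n
<-rankCombine {a = zero}  {suc b} z≤n _   = s≤s z≤n
<-rankCombine {a = suc a} {zero}  _   z≤n = s≤s z≤n
<-rankCombine {a = suc a} {suc b} z≤n _   = s≤s z≤n
<-rankCombine {a = suc a} {suc b} (s≤s p) (s≤s q) = s≤s (<-rankCombine p q)

rankCombine-diag : ∀ a → rankCombine a a ≡ suc a
rankCombine-diag zero    = refl
rankCombine-diag (suc a) = cong suc (rankCombine-diag a)

eval-node : ∀ {V} {v : V} {t₀ t₁ : DTree V} {x : V → Bool} b → x v ≡ b →
            eval (node v t₀ t₁) x ≡ eval (if b then t₁ else t₀) x
eval-node true  eq rewrite eq = refl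
eval-node false eq rewrite eq = refl

rename : ∀ {V W} → (V → W) → DTree V → DTree W
rename h (leaf b)       = leaf b
rename h (node v t₀ t₁) = node (h v) (rename h t₀) (rename h t₁)

eval-rename : ∀ {V W} (h : V → W) t x → eval (rename h t) x ≡ eval t (λ v → x (h v))
eval-rename h (leaf b)       x = refl
eval-rename h (node v t₀ t₁) x with x (h v)
... | true  = eval-rename h t₁ x
... | false = eval-rename h t₀ x

rank-rename : ∀ {V W} (h : V → W) t → rank (rename h t) ≡ rank t
rank-rename h (leaf b) = refl
rank-rename h (node v t₀ t₁) rewrite rank-rename h t₀ | rank-rename h t₁ = refl

nonconstant⇒1≤rank : ∀ {V} {f : (V → Bool) → Bool} {x y} (t : DTree V) →
                     Computes t f → f x ≢ f y → 1 ≤ rank t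
nonconstant⇒1≤rank {x = x} {y} (leaf b) c fx≢fy = contradiction (trans (sym (c x)) (c y)) fx≢fy
nonconstant⇒1≤rank (node v t₀ t₁) c fx≢fy = <-rankCombine z≤n z≤n

module RankLowerBound {V R : Set} (F : (V → Bool) → Bool)
                      (_admits_ : R → (V → Bool) → Set) (measure : R → ℕ) where

  data Response (ρ : R) (v : V) : Set where
    forced : ∀ b → (∀ x → ρ admits x → x v ≡ b) → Response ρ v
    split  : (ρ′ : Bool → R) → (∀ b → measure ρ ≡ suc (measure (ρ′ b))) →
             (∀ b x → ρ′ b admits x → ρ admits x × x v ≡ b) → Response ρ v

  module _ (undetermined : ∀ ρ → 0 < measure ρ → ∃₂ λ x y → ρ admits x × ρ admits y × F x ≢ F y)
           (respond : ∀ ρ v → Response ρ v) where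

    measure≤rank : ∀ t ρ → (∀ x → ρ admits x → eval t x ≡ F x) → measure ρ ≤ rank t
    measure≤rank (leaf b) ρ agree = ≮⇒≥ λ 0<μ →
      let (x , y , ρx , ρy , Fx≢Fy) = undetermined ρ 0<μ
      in Fx≢Fy (trans (sym (agree x ρx)) (agree y ρy))
    measure≤rank (node v t₀ t₁) ρ agree with respond ρ v
    ... | forced false isFalse = ≤-trans
          (measure≤rank t₀ ρ λ x ρx → trans (sym (eval-node {t₀ = t₀} {t₁} false (isFalse x ρx))) (agree x ρx))
          (≤-rankCombineˡ (rank t₀) (rank t₁))
    ... | forced true isTrue = ≤-trans
          (measure≤rank t₁ ρ λ x ρx → trans (sym (eval-node {t₀ = t₀} {t₁} true (isTrue x ρx))) (agree x ρx))
          (≤-rankCombineʳ (rank t₀) (rank t₁))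
    ... | split ρ′ μ≡ refines = subst (_≤ rank (node v t₀ t₁)) (sym (μ≡ false))
          (<-rankCombine (measure≤rank t₀ (ρ′ false) (agreeOn false))
                         (subst (_≤ rank t₁) (suc-injective (trans (sym (μ≡ true)) (μ≡ false)))
                                (measure≤rank t₁ (ρ′ true) (agreeOn true))))
      where
        agreeOn : ∀ b x → ρ′ b admits x → eval (if b then t₁ else t₀) x ≡ F x
        agreeOn b x ρ′x = let (ρx , xv≡b) = refines b x ρ′x
                          in trans (sym (eval-node b xv≡b)) (agree x ρx)

nothings : ∀ {A : Set} {n} → Vector (Maybe A) n → ℕ
nothings {n = zero}  σ = 0
nothings {n = suc n} σ = maybe′ (const 0) 1 (σ zero) + nothings (λ i → σ (suc i))

nothings-const : ∀ {A : Set} n → nothings {A} {n} (const nothing) ≡ n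
nothings-const zero    = refl
nothings-const (suc n) = cong suc (nothings-const n)

nothings-updateAt : ∀ {A : Set} {n} (σ : Vector (Maybe A) n) i a → σ i ≡ nothing →
                    nothings σ ≡ suc (nothings (updateAt σ i (const (just a))))
nothings-updateAt σ zero    a eq rewrite eq = refl
nothings-updateAt σ (suc i) a eq =
  trans (cong (maybe′ (const 0) 1 (σ zero) +_) (nothings-updateAt (λ j → σ (suc j)) i a eq))
        (+-suc (maybe′ (const 0) 1 (σ zero)) _)

0<nothings⇒∃nothing : ∀ {A : Set} {n} (σ : Vector (Maybe A) n) → 0 < nothings σ →
                       ∃ λ i → σ i ≡ nothing
0<nothings⇒∃nothing {n = suc n} σ 0<μ with σ zero in eq
... | nothing = zero , eq
... | just _  = let (i , σi≡nothing) = 0<nothings⇒∃nothing (λ j → σ (suc j)) 0<μ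
                in suc i , σi≡nothing

AND : ∀ {n} → BoolFn n
AND {zero}  a = true
AND {suc n} a = a zero ∧ AND (λ i → a (suc i))

AND-true : ∀ {n} (a : Fin n → Bool) → (∀ i → a i ≡ true) → AND a ≡ true
AND-true {zero}  a all = refl
AND-true {suc n} a all rewrite all zero = AND-true (λ i → a (suc i)) (λ i → all (suc i))

AND-false : ∀ {n} (a : Fin n → Bool) i → a i ≡ false → AND a ≡ false
AND-false a zero eq rewrite eq = refl
AND-false a (suc i) eq with a zero
... | true  = AND-false (λ j → a (suc j)) i eq
... | false = refl

OR₂ : BoolFn 2
OR₂ a = a zero ∨ a (suc zero)

andTree : ∀ n → DTree (Fin n)
andTree zero    = leaf true
andTree (suc n) = node zero (leaf false) (rename suc (andTree n))

andTree-computes : ∀ n → Computes (andTree n) AND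
andTree-computes zero    x = refl
andTree-computes (suc n) x with x zero
... | false = refl
... | true  = trans (eval-rename suc (andTree n) x) (andTree-computes n (λ i → x (suc i)))

rank-andTree : ∀ n → rank (andTree (suc n)) ≡ 1
rank-andTree zero    = refl
rank-andTree (suc n) = cong (rankCombine 0) (trans (rank-rename suc (andTree (suc n))) (rank-andTree n))

isRank-AND : ∀ n → IsRank (AND {suc n}) 1
isRank-AND n = (andTree (suc n) , andTree-computes (suc n) , rank-andTree n) ,
  λ t c → nonconstant⇒1≤rank {x = const true} {const false} t c
            (subst (_≢ false) (sym (AND-true {suc n} (const true) λ _ → refl)) λ ())

orTree : DTree (Fin 2)
orTree = node zero (node (suc zero) (leaf false) (leaf true)) (leaf true)

orTree-computes : Computes orTree OR₂
orTree-computes x with x zero | x (suc zero)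
... | true  | _     = refl
... | false | true  = refl
... | false | false = refl

isRank-OR₂ : IsRank OR₂ 1
isRank-OR₂ = (orTree , orTree-computes , refl) ,
  λ t c → nonconstant⇒1≤rank {x = const true} {const false} t c λ ()

Blocks : ℕ → Set
Blocks k = Fin k × Fin 2

AND∘OR₂ : ∀ {k} → (Blocks k → Bool) → Bool
AND∘OR₂ = AND ∘ᵇ OR₂

andOrTree : ∀ k → DTree (Blocks k)
andOrTree zero    = leaf true
andOrTree (suc k) = node (zero , zero) (node (zero , suc zero) (leaf false) rest) rest
  where rest = rename (map₁ suc) (andOrTree k)

andOrTree-computes : ∀ k → Computes (andOrTree k) AND∘OR₂
andOrTree-computes zero    x = refl
andOrTree-computes (suc k) x with x (zero , zero) | x (zero , suc zero)
... | true  | _     = trans (eval-rename (map₁ suc) (andOrTree k) x) (andOrTree-computes k _)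
... | false | true  = trans (eval-rename (map₁ suc) (andOrTree k) x) (andOrTree-computes k _)
... | false | false = refl

rank-andOrTree : ∀ k → rank (andOrTree k) ≡ k
rank-andOrTree zero          = refl
rank-andOrTree (suc zero)    = refl
rank-andOrTree (suc (suc k)) =
  trans (cong (λ r → rankCombine (rankCombine 0 r) r)
              (trans (rank-rename (map₁ suc) (andOrTree (suc k))) (rank-andOrTree (suc k))))
        (rankCombine-diag (suc k))

data Pattern : Set where
  ones   : Pattern
  zeroAt : Fin 2 → Pattern

bits : Pattern → Fin 2 → Bool
bits (zeroAt zero)       zero       = false
bits (zeroAt (suc zero)) (suc zero) = false
bits _                   _          = true

OR₂-bits : ∀ p → OR₂ (bits p) ≡ true
OR₂-bits ones                = refl
OR₂-bits (zeroAt zero)       = refl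
OR₂-bits (zeroAt (suc zero)) = refl

answer : Bool → Fin 2 → Pattern
answer false = zeroAt
answer true  = const ones

bits-answer : ∀ b j → bits (answer b j) j ≡ b
bits-answer false zero       = refl
bits-answer false (suc zero) = refl
bits-answer true  j          = refl

Restriction : ℕ → Set
Restriction k = Vector (Maybe Pattern) k

Agrees : Maybe Pattern → (Fin 2 → Bool) → Set
Agrees nothing  y = ⊤
Agrees (just p) y = ∀ j → y j ≡ bits p j

_admits_ : ∀ {k} → Restriction k → (Blocks k → Bool) → Set
σ admits x = ∀ i → Agrees (σ i) (λ j → x (i , j))

admits-updateAt : ∀ {k} (σ : Restriction k) i f x → σ i ≡ nothing →
                  updateAt σ i f admits x → σ admits x
admits-updateAt σ i f x σi≡nothing adm i′ with i′ ≟ i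
... | yes refl = subst (λ b → Agrees b _) (sym σi≡nothing) tt
... | no i′≢i  = subst (λ b → Agrees b _) (updateAt-minimal i′ i σ i′≢i) (adm i′)

fill : ∀ {k} → Restriction k → Fin k → Fin 2 → Bool
fill σ i = bits (fromMaybe ones (σ i))

admits-fill : ∀ {k} (σ : Restriction k) → σ admits uncurry (fill σ)
admits-fill σ i with σ i
... | nothing = tt
... | just p  = λ j → refl

AND∘OR₂-fill : ∀ {k} (σ : Restriction k) → AND∘OR₂ (uncurry (fill σ)) ≡ true
AND∘OR₂-fill σ = AND-true _ λ i → OR₂-bits (fromMaybe ones (σ i))

kill : ∀ {k} → Restriction k → Fin k → Fin k → Fin 2 → Bool
kill σ i = updateAt (fill σ) i (const (const false))

admits-kill : ∀ {k} (σ : Restriction k) i → σ i ≡ nothing → σ admits uncurry (kill σ i)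
admits-kill σ i σi≡nothing i′ with i′ ≟ i
... | yes refl = subst (λ b → Agrees b (kill σ i i)) (sym σi≡nothing) tt
... | no i′≢i  = subst (Agrees (σ i′)) (sym (updateAt-minimal i′ i (fill σ) i′≢i)) (admits-fill σ i′)

AND∘OR₂-kill : ∀ {k} (σ : Restriction k) i → AND∘OR₂ (uncurry (kill σ i)) ≡ false
AND∘OR₂-kill σ i = AND-false _ i (cong OR₂ (updateAt-updates i (fill σ)))

module _ {k : ℕ} where
  open RankLowerBound (AND∘OR₂ {k}) _admits_ (nothings {n = k})

  undetermined : ∀ (σ : Restriction k) → 0 < nothings σ →
                 ∃₂ λ x y → σ admits x × σ admits y × AND∘OR₂ x ≢ AND∘OR₂ y
  undetermined σ 0<μ =
    let (i , σi≡nothing) = 0<nothings⇒∃nothing σ 0<μ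
    in uncurry (fill σ) , uncurry (kill σ i) , admits-fill σ , admits-kill σ i σi≡nothing ,
       λ eq → true≢false (trans (sym (AND∘OR₂-fill σ)) (trans eq (AND∘OR₂-kill σ i)))
    where true≢false : true ≢ false
          true≢false ()

  respond : ∀ σ v → Response σ v
  respond σ (i , j) with σ i in σi≡
  ... | just p  = forced (bits p j) λ x adm → subst (λ b → Agrees b (λ j → x (i , j))) σi≡ (adm i) j
  ... | nothing = split (λ b → updateAt σ i (const (just (answer b j))))
                        (λ b → nothings-updateAt σ i (answer b j) σi≡)
                        λ b x adm → admits-updateAt σ i _ x σi≡ adm ,
                          trans (subst (λ c → Agrees c (λ j → x (i , j))) (updateAt-updates i σ) (adm i) j)
                                (bits-answer b j)

  isRank-AND∘OR₂ : IsRank (AND∘OR₂ {k}) k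
  isRank-AND∘OR₂ = (andOrTree k , andOrTree-computes k , rank-andOrTree k) ,
    λ t c → subst (_≤ rank t) (nothings-const k)
                  (measure≤rank undetermined respond t (const nothing) λ x _ → c x)

lemma6p2 : ¬ (∃ λ (B : ℕ → ℕ → ℕ) →
    ∀ (n m : ℕ) (f : BoolFn n) (g : BoolFn m) (rf rg rfg : ℕ) →
    IsRank f rf → IsRank g rg → IsRank (f ∘ᵇ g) rfg →
    rfg ≤ B rf rg)
lemma6p2 (B , bound) =
  1+n≰n (bound k 2 AND OR₂ 1 1 k (isRank-AND (B 1 1)) isRank-OR₂ isRank-AND∘OR₂)
  where k = suc (B 1 1)
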